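{- Let $k\ge 3$ be an integer and let $n\ge k-1$ be an integer. If $\nu_k(n)=0$, then $n-k+3$ is prime.
   Context: For an integer $k\ge 3$ and a positive integer $n$, $\nu_k(n)$ denotes the number of $k$-tuples of integers $(x_1,\dots,x_k)$ with $1\le x_1\le x_2\le\dots\le x_k$ such that $n = x_1x_2\cdots x_k + x_1+x_2+\dots+x_k$. -}

module Defs where

open import Data.Nat using (ℕ; zero; suc; _+_; _*_; _∸_; _≟_)
open import Data.List using (List; []; _∷_; map; concatMap; filter; length)
open import Data.Nat.ListAction using (sum; product)
open import Data.List.Base using (upTo)

nondecTuples : ℕ → ℕ → ℕ → List (List ℕ)
nondecTuples zero    lo n = [] ∷ []
nondecTuples (suc k) lo n =
  concatMap (λ d → map (λ xs → (lo + d) ∷ xs) (nondecTuples k (lo + d) n))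
            (upTo (suc n ∸ lo))

-- Tuples (x₁,…,x_k), 1 ≤ x₁ ≤ … ≤ x_k, with n = x₁⋯x_k + x₁ + ⋯ + x_k.
-- Every such xᵢ satisfies xᵢ ≤ n, so enumerating entries in [1, n] is exhaustive.
solutions : ℕ → ℕ → List (List ℕ)
solutions k n = filter (λ xs → n ≟ product xs + sum xs) (nondecTuples k 1 n)

ν : ℕ → ℕ → ℕ
ν k n = length (solutions k n)

{-# OPTIONS --safe #-}
-- If n − k + 3 = (a + 1)(b + 1) with 1 ≤ a ≤ b, then the tuple (1, …, 1, a, b) with k − 2 ones
-- solves n = x₁⋯x_k + x₁ + ⋯ + x_k, since its product is a b and its sum is k − 2 + a + b.
-- So ν k n = 0 forces n − k + 3 to have no such factorisation, i.e. to be prime.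
module Submission where

open import Defs
open import Data.Nat
  using (ℕ; zero; suc; _+_; _*_; _∸_; _≤_; _<_; _≟_; s≤s; n>1⇒nonTrivial; nonTrivial⇒n>1)
open import Data.Nat.Properties
open import Data.Nat.Divisibility using (divides; quotient>1)
open import Data.Nat.Primality using (Prime; Composite; composite; ¬composite⇒prime)
open import Data.Nat.ListAction using (sum; product)
open import Data.List using (List; []; _∷_; _++_; replicate; length; map)
open import Data.List.Membership.Propositional using (_∈_)
open import Data.List.Membership.Propositional.Properties
  using (∈-concatMap⁺; ∈-map⁺; ∈-upTo⁺; ∈-filter⁺)
open import Data.List.Properties using (length-++; length-replicate)
open import Data.List.Relation.Unary.Any as Any using (here; there)
open import Data.Product using (∃₂; _×_; _,_)
open import Data.Sum using (inj₁; inj₂)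
open import Relation.Nullary using (¬_)
open import Relation.Binary.PropositionalEquality
  using (_≡_; _≢_; refl; sym; trans; cong; cong₂; subst; module ≡-Reasoning)
open import Data.Nat.Solver using (module +-*-Solver)

data NondecBelow (n : ℕ) : ℕ → List ℕ → Set where
  []  : ∀ {lo} → NondecBelow n lo []
  _∷_ : ∀ {lo x xs} → lo ≤ x × x ≤ n → NondecBelow n x xs → NondecBelow n lo (x ∷ xs)

∈-nondecTuples : ∀ {n lo xs} → NondecBelow n lo xs → xs ∈ nondecTuples (length xs) lo n
∈-nondecTuples [] = here refl
∈-nondecTuples {n} {lo} (_∷_ {x = x} {xs} (lo≤x , x≤n) rest) =
  ∈-concatMap⁺ _ (Any.map (λ { refl → x∷xs∈block }) (∈-upTo⁺ offset<range))
  where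
  offset<range : x ∸ lo < suc n ∸ lo
  offset<range = ∸-monoˡ-< (s≤s x≤n) lo≤x
  x∷xs∈block : x ∷ xs ∈ map ((lo + (x ∸ lo)) ∷_) (nondecTuples (length xs) (lo + (x ∸ lo)) n)
  x∷xs∈block rewrite m+[n∸m]≡n lo≤x = ∈-map⁺ (x ∷_) (∈-nondecTuples rest)

∈-solutions : ∀ {n xs} → NondecBelow n 1 xs → n ≡ product xs + sum xs →
              xs ∈ solutions (length xs) n
∈-solutions {n} xs↑ n≡ = ∈-filter⁺ (λ ys → n ≟ product ys + sum ys) (∈-nondecTuples xs↑) n≡

∈⇒length≢0 : ∀ {A : Set} {x : A} {xs} → x ∈ xs → length xs ≢ 0
∈⇒length≢0 (here _)  ()
∈⇒length≢0 (there _) ()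

replicate-1-++ : ∀ {n ys} j → 1 ≤ n → NondecBelow n 1 ys → NondecBelow n 1 (replicate j 1 ++ ys)
replicate-1-++ zero    1≤n ys↑ = ys↑
replicate-1-++ (suc j) 1≤n ys↑ = (≤-refl , 1≤n) ∷ replicate-1-++ j 1≤n ys↑

product-replicate-1-++ : ∀ j ys → product (replicate j 1 ++ ys) ≡ product ys
product-replicate-1-++ zero    ys = refl
product-replicate-1-++ (suc j) ys = trans (+-identityʳ _) (product-replicate-1-++ j ys)

sum-replicate-1-++ : ∀ j ys → sum (replicate j 1 ++ ys) ≡ j + sum ys
sum-replicate-1-++ zero    ys = refl
sum-replicate-1-++ (suc j) ys = cong suc (sum-replicate-1-++ j ys)

ν-shiftedProduct≢0 : ∀ i a b → 1 ≤ a → a ≤ b → ν (3 + i) (suc a * suc b + i) ≢ 0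
ν-shiftedProduct≢0 i a b 1≤a a≤b =
  ∈⇒length≢0 (subst (λ k → witness ∈ solutions k n) length-witness (∈-solutions witness↑ n≡))
  where
  n = suc a * suc b + i
  ab = a ∷ b ∷ []
  witness = replicate (suc i) 1 ++ ab

  b≤n : b ≤ n
  b≤n = ≤-trans (n≤1+n b) (≤-trans (m≤m+n (suc b) (a * suc b)) (m≤m+n _ i))

  a≤n : a ≤ n
  a≤n = ≤-trans a≤b b≤n

  witness↑ : NondecBelow n 1 witness
  witness↑ = replicate-1-++ (suc i) (≤-trans 1≤a a≤n) ((1≤a , a≤n) ∷ (a≤b , b≤n) ∷ [])

  length-witness : length witness ≡ 3 + i
  length-witness = trans (length-++ (replicate (suc i) 1))
                         (trans (cong (_+ 2) (length-replicate (suc i))) (+-comm (suc i) 2))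

  n≡ : n ≡ product witness + sum witness
  n≡ = begin
    suc a * suc b + i              ≡⟨ expand a b i ⟩
    product ab + (suc i + sum ab)  ≡⟨ sym (cong₂ _+_ (product-replicate-1-++ (suc i) ab)
                                                     (sum-replicate-1-++ (suc i) ab)) ⟩
    product witness + sum witness  ∎
    where
    open ≡-Reasoning
    open +-*-Solver
    expand : ∀ a b i → suc a * suc b + i ≡ product (a ∷ b ∷ []) + (suc i + sum (a ∷ b ∷ []))
    expand = solve 3 (λ a b i → (con 1 :+ a) :* (con 1 :+ b) :+ i
                              := a :* (b :* con 1) :+ (con 1 :+ i :+ (a :+ (b :+ con 0)))) refl

>1×>1⇒shiftedFactors : ∀ {m d q} → 1 < d → 1 < q → m ≡ q * d →
                        ∃₂ λ a b → 1 ≤ a × a ≤ b × m ≡ suc a * suc b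
>1×>1⇒shiftedFactors {d = suc d} {suc q} (s≤s 1≤d) (s≤s 1≤q) m≡ with ≤-total d q
... | inj₁ d≤q = d , q , 1≤d , d≤q , trans m≡ (*-comm (suc q) (suc d))
... | inj₂ q≤d = q , d , 1≤q , q≤d , m≡

composite⇒shiftedFactors : ∀ {m} → Composite m → ∃₂ λ a b → 1 ≤ a × a ≤ b × m ≡ suc a * suc b
composite⇒shiftedFactors (composite {d} d<m d∣m@(divides q m≡q*d)) =
  >1×>1⇒shiftedFactors (nonTrivial⇒n>1 d) (quotient>1 d∣m d<m) m≡q*d

proposition2 : (k n : ℕ) → 3 ≤ k → k ∸ 1 ≤ n → ν k n ≡ 0 → Prime ((n + 3) ∸ k)
proposition2 (suc (suc (suc i))) n (s≤s (s≤s (s≤s _))) 2+i≤n ν≡0 =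
  subst Prime (cong (_∸ (3 + i)) (+-comm 3 n)) (¬composite⇒prime {{n>1⇒nonTrivial 1<m}} m-not-composite)
  where
  m = n ∸ i
  i≤n : i ≤ n
  i≤n = ≤-trans (m≤n+m i 2) 2+i≤n
  1<m : 1 < m
  1<m = m+n≤o⇒m≤o∸n 2 2+i≤n
  m-not-composite : ¬ Composite m
  m-not-composite m-composite with composite⇒shiftedFactors m-composite
  ... | a , b , 1≤a , a≤b , m≡ =
    ν-shiftedProduct≢0 i a b 1≤a a≤b (subst (λ N → ν (3 + i) N ≡ 0) n≡ ν≡0)
    where
    n≡ : n ≡ suc a * suc b + i
    n≡ = trans (sym (m∸n+n≡m i≤n)) (cong (_+ i) m≡)
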